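{- For every graph $G$, $\zeta_1(G)\le \Delta(G)\,\mathrm{prox}_1(G)$.
   Context: All graphs are finite, connected, and without multiple edges. For a vertex $x$, $N(x)$ is its set of neighbours ($x\notin N(x)$) and $N[x]=N(x)\cup\{x\}$; $\Delta(G)$ is the maximum degree. The one-visibility Localization game with $k$ cops on a graph $G$: the robber first chooses a starting vertex; then in each round the cops choose (probe) vertices $u_1,\dots,u_k$ of $G$ (any vertices), and for each $i$ the probe returns $0$ if the robber is on $u_i$, $1$ if the robber is adjacent to $u_i$, and $\ast$ otherwise; then the robber moves to a vertex of $N[v]$, where $v$ is its current vertex. The cops win if after finitely many rounds the information obtained determines the robber's current vertex uniquely; the robber is omniscient. $\zeta_1(G)$ is the least positive integer $k$ such that $k$ cops have a winning strategy. The one-proximity game is the same except that the cops win as soon as some probe returns a value other than $\ast$; $\mathrm{prox}_1(G)$ is the least number of cops having a winning strategy in it. -}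

module Defs where

open import Data.Nat using (ℕ; zero; suc; _≤_; _⊔_)
open import Data.Fin using (Fin)
open import Data.List using (List; []; _∷_; length; filter; map; foldr; allFin)
open import Data.Vec using (Vec)
import Data.Vec as Vec
open import Data.Vec.Relation.Unary.Any using (Any)
open import Data.Product using (∃; _×_; Σ)
open import Data.Sum using (_⊎_)
open import Data.Empty using (⊥)
open import Relation.Nullary using (¬_; Dec; yes; no)
open import Relation.Binary.PropositionalEquality using (_≡_; _≢_)
open import Data.Fin using (_≟_)

data Reach {n : ℕ} (R : Fin n → Fin n → Set) : Fin n → Fin n → Set where
  reach-refl : ∀ {u} → Reach R u u
  reach-step : ∀ {u v w} → R u v → Reach R v w → Reach R u w

record Graph : Set₁ where
  field
    n         : ℕ
    nonempty  : 1 ≤ n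
    Adj       : Fin n → Fin n → Set
    adj?      : ∀ u v → Dec (Adj u v)
    sym       : ∀ {u v} → Adj u v → Adj v u
    irrefl    : ∀ {u} → ¬ Adj u u
    connected : ∀ u v → Reach Adj u v

open Graph public

nbrs : (G : Graph) → Fin (n G) → List (Fin (n G))
nbrs G x = filter (adj? G x) (allFin (n G))

degree : (G : Graph) → Fin (n G) → ℕ
degree G x = length (nbrs G x)

Δ : Graph → ℕ
Δ G = foldr _⊔_ 0 (map (degree G) (allFin (n G)))

ClosedNbr : (G : Graph) → Fin (n G) → Fin (n G) → Set
ClosedNbr G x y = x ≡ y ⊎ Adj G x y

-- w t is the robber's vertex during round t (i.e. when round t's probes are made)
IsWalk : (G : Graph) → (ℕ → Fin (n G)) → Set
IsWalk G w = ∀ t → ClosedNbr G (w t) (w (suc t))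

data Answer : Set where
  ans0   : Answer
  ans1   : Answer
  ans∗   : Answer

probe : (G : Graph) → (u r : Fin (n G)) → Answer
probe G u r with u ≟ r
... | yes _ = ans0
... | no  _ with adj? G u r
...   | yes _ = ans1
...   | no  _ = ans∗

-- History of answers seen so far (most recent round first).
History : ℕ → Set
History k = List (Vec Answer k)

-- A (deterministic) strategy for k cops: from the answers received so far,
-- choose the k probed vertices of the next round.  (Since the robber is
-- omniscient, deterministic strategies are the relevant ones.)
Strategy : Graph → ℕ → Set
Strategy G k = History k → Vec (Fin (n G)) k

mutual
  roundAnswers : (G : Graph) {k : ℕ} → Strategy G k → (ℕ → Fin (n G)) → ℕ → Vec Answer k
  roundAnswers G σ w t = Vec.map (λ u → probe G u (w t)) (σ (history G σ w t))

  history : (G : Graph) {k : ℕ} → Strategy G k → (ℕ → Fin (n G)) → ℕ → History k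
  history G σ w zero    = []
  history G σ w (suc t) = roundAnswers G σ w t ∷ history G σ w t

-- After round t (t+1 rounds played) the information determines the robber's
-- current vertex: every robber trajectory producing the same answers is at
-- the same vertex.
Located : (G : Graph) {k : ℕ} → Strategy G k → (ℕ → Fin (n G)) → ℕ → Set
Located G σ w t =
  ∀ w' → IsWalk G w' → history G σ w' (suc t) ≡ history G σ w (suc t) → w' t ≡ w t

LocWinning : (G : Graph) (k : ℕ) → Strategy G k → Set
LocWinning G k σ = ∀ w → IsWalk G w → ∃ λ t → Located G σ w t

LocCopsWin : Graph → ℕ → Set
LocCopsWin G k = Σ (Strategy G k) (LocWinning G k)

IsZeta1 : Graph → ℕ → Set
IsZeta1 G z = 1 ≤ z × LocCopsWin G z × (∀ k → 1 ≤ k → LocCopsWin G k → z ≤ k)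

ProxWinning : (G : Graph) (k : ℕ) → Strategy G k → Set
ProxWinning G k σ = ∀ w → IsWalk G w → ∃ λ t → Any (λ a → a ≢ ans∗) (roundAnswers G σ w t)

ProxCopsWin : Graph → ℕ → Set
ProxCopsWin G k = Σ (Strategy G k) (ProxWinning G k)

IsProx1 : Graph → ℕ → Set
IsProx1 G p = ProxCopsWin G p × (∀ k → ProxCopsWin G k → p ≤ k)

-- A one-proximity strategy σ for p cops only ever needs to react to the history in which every
-- probe answered ∗: until the first non-∗ answer that is the history it has seen. So its
-- probes along this silent play form a fixed schedule. Replace each probed vertex u by u together
-- with all but one of its neighbours, at most Δ probes. In the round where σ first gets an answer
-- from u, the robber is on u or adjacent to u, and the probes of u's neighbours (a 0 reveals the
-- robber, no 0 means it is the omitted neighbour) pin it down.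
module Submission where

open import Defs
open import Data.Nat using (ℕ; zero; suc; _≤_; _*_; _∸_; _⊔_; z≤n; s≤s)
open import Data.Nat.Properties using (≤-trans; ≤-reflexive; m≤m⊔n; m≤n⊔m; +-mono-≤; *-comm; *-mono-≤)
open import Data.Fin as Fin using (Fin; _≟_)
open import Data.Fin.Properties using (toℕ-fromℕ<)
open import Data.List as List using (List; []; _∷_; length; foldr; concatMap)
open import Data.List.Properties using (length-++; length-drop; ∷-injectiveˡ)
open import Data.List.Membership.Propositional using (lose) renaming (_∈_ to _∈ₗ_)
open import Data.List.Membership.Propositional.Properties using (∈-allFin; ∈-filter⁺; ∈-concatMap⁺)
open import Data.List.Relation.Unary.Any as ListAny using ()
open import Data.Vec as Vec using (Vec; []; _∷_)
open import Data.Vec.Properties using (length-toList)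
open import Data.Vec.Membership.Propositional using (_∈_; find)
open import Data.Vec.Membership.Propositional.Properties using (∈-fromList⁺; ∈-toList⁺)
open import Data.Vec.Relation.Unary.Any using (Any; here; there; any?)
open import Data.Vec.Relation.Unary.Any.Properties using (map⁻)
open import Data.Product using (∃; _×_; _,_; uncurry)
open import Data.Sum using (_⊎_; inj₁; inj₂)
open import Data.Empty using (⊥-elim)
open import Relation.Nullary using (¬_; Dec; yes; no; ¬?)
open import Relation.Binary.PropositionalEquality
  using (_≡_; _≢_; refl; trans; cong; cong₂; subst) renaming (sym to ≡-sym)

map-cong⁻ : ∀ {A B : Set} {k} {f g : A → B} {x} (xs : Vec A k) →
  Vec.map f xs ≡ Vec.map g xs → x ∈ xs → f x ≡ g x
map-cong⁻ (_ ∷ _)  eq (here refl) = cong Vec.head eq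
map-cong⁻ (_ ∷ xs) eq (there x∈)  = map-cong⁻ xs (cong Vec.tail eq) x∈

∈-padRight⁺ : ∀ {A : Set} {k m} {x a : A} {xs : Vec A k} (k≤m : k ≤ m) →
  x ∈ xs → x ∈ Vec.padRight k≤m a xs
∈-padRight⁺ (s≤s _)   (here refl) = here refl
∈-padRight⁺ (s≤s k≤m) (there x∈)  = there (∈-padRight⁺ k≤m x∈)

length-concatMap-≤ : ∀ {A B : Set} {f : A → List B} {d} → (∀ x → length (f x) ≤ d) →
  ∀ xs → length (concatMap f xs) ≤ length xs * d
length-concatMap-≤ bound []       = z≤n
length-concatMap-≤ {f = f} bound (x ∷ xs)
  rewrite length-++ (f x) {concatMap f xs} = +-mono-≤ (bound x) (length-concatMap-≤ bound xs)

≤-foldr-⊔ : ∀ {A : Set} (f : A → ℕ) {x} {xs : List A} → x ∈ₗ xs → f x ≤ foldr _⊔_ 0 (List.map f xs)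
≤-foldr-⊔ f {xs = y ∷ _} (ListAny.here refl) = m≤m⊔n (f y) _
≤-foldr-⊔ f {xs = y ∷ _} (ListAny.there x∈) = ≤-trans (≤-foldr-⊔ f x∈) (m≤n⊔m (f y) _)

suc[m∸1]≤n : ∀ {m n} → 1 ≤ n → m ≤ n → suc (m ∸ 1) ≤ n
suc[m∸1]≤n {zero}  1≤n _   = 1≤n
suc[m∸1]≤n {suc _} _   m≤n = m≤n

is-∗? : (a : Answer) → Dec (a ≡ ans∗)
is-∗? ans0 = no λ ()
is-∗? ans1 = no λ ()
is-∗? ans∗ = yes refl

all-∗ : ∀ {k} (as : Vec Answer k) → ¬ Any (_≢ ans∗) as → as ≡ Vec.replicate k ans∗
all-∗ []          _    = refl
all-∗ (ans0 ∷ _)  ¬any = ⊥-elim (¬any (here λ ()))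
all-∗ (ans1 ∷ _)  ¬any = ⊥-elim (¬any (here λ ()))
all-∗ (ans∗ ∷ as) ¬any = cong (ans∗ ∷_) (all-∗ as (λ any → ¬any (there any)))

¬Any-Vec0 : ∀ {A : Set} {P : A → Set} (xs : Vec A 0) → ¬ Any P xs
¬Any-Vec0 [] ()

∈⇒1≤length : ∀ {A : Set} {x : A} {xs : List A} → x ∈ₗ xs → 1 ≤ length xs
∈⇒1≤length {xs = _ ∷ _} _ = s≤s z≤n

first-step : ∀ {k} {R : Fin k → Fin k → Set} {a b} → Reach R a b → a ≡ b ⊎ ∃ (R a)
first-step reach-refl         = inj₁ refl
first-step (reach-step a~v _) = inj₂ (_ , a~v)

silence : (k t : ℕ) → History k
silence k t = List.replicate t (Vec.replicate k ans∗)

module _ (G : Graph) where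

  private
    V : Set
    V = Fin (n G)

  answers : ∀ {k} → Vec V k → V → Vec Answer k
  answers P r = Vec.map (λ x → probe G x r) P

  probe-refl : ∀ x → probe G x x ≡ ans0
  probe-refl x with x ≟ x
  ... | yes _   = refl
  ... | no x≢x = ⊥-elim (x≢x refl)

  probe≡ans0⇒≡ : ∀ {u r} → probe G u r ≡ ans0 → u ≡ r
  probe≡ans0⇒≡ {u} {r} e with u ≟ r
  ... | yes u≡r = u≡r
  ... | no _ with adj? G u r
  probe≡ans0⇒≡ () | no _ | yes _
  probe≡ans0⇒≡ () | no _ | no _

  probe≡ans1⇒Adj : ∀ {u r} → probe G u r ≡ ans1 → Adj G u r
  probe≡ans1⇒Adj {u} {r} e with u ≟ r
  probe≡ans1⇒Adj () | yes _
  ... | no _ with adj? G u r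
  ... | yes u~r = u~r
  probe≡ans1⇒Adj () | no _ | no _

  Adj⇒∈nbrs : ∀ {u r} → Adj G u r → r ∈ₗ nbrs G u
  Adj⇒∈nbrs {u} {r} = ∈-filter⁺ (adj? G u) (∈-allFin r)

  degree≤Δ : ∀ u → degree G u ≤ Δ G
  degree≤Δ u = ≤-foldr-⊔ (degree G) (∈-allFin u)

  Δ-positive : 2 ≤ n G → 1 ≤ Δ G
  Δ-positive 2≤n with first-step (connected G (Fin.fromℕ< (nonempty G)) (Fin.fromℕ< 2≤n))
  ... | inj₁ 0≡1 with () ← trans (≡-sym (toℕ-fromℕ< (nonempty G)))
                                 (trans (cong Fin.toℕ 0≡1) (toℕ-fromℕ< 2≤n))
  ... | inj₂ (_ , 0~v) = ≤-trans (∈⇒1≤length (Adj⇒∈nbrs 0~v)) (degree≤Δ _)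

  watch : V → List V
  watch u = u ∷ List.drop 1 (nbrs G u)

  -- probe x r ≡ ans0 only for r ≡ x, so the unprobed head is the one element no probe reports.
  probes-on-tail-separate : ∀ (xs : List V) {r r'} → r ∈ₗ xs → r' ∈ₗ xs →
    (∀ {x} → x ∈ₗ List.drop 1 xs → probe G x r' ≡ probe G x r) → r' ≡ r
  probes-on-tail-separate (_ ∷ _) (ListAny.here refl) (ListAny.here refl) _ = refl
  probes-on-tail-separate (_ ∷ _) {r} (ListAny.there r∈) _ agree =
    ≡-sym (probe≡ans0⇒≡ {r} (trans (agree r∈) (probe-refl r)))
  probes-on-tail-separate (_ ∷ _) {r' = r'} (ListAny.here _) (ListAny.there r'∈) agree =
    probe≡ans0⇒≡ {r'} (trans (≡-sym (agree r'∈)) (probe-refl r'))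

  watch-locates : ∀ {u r r'} → probe G u r ≢ ans∗ →
    (∀ {x} → x ∈ₗ watch u → probe G x r' ≡ probe G x r) → r' ≡ r
  watch-locates {u} {r} seen agree with probe G u r in e
  ... | ans0 = trans (≡-sym (probe≡ans0⇒≡ {u} (trans (agree (ListAny.here refl)) e)))
                     (probe≡ans0⇒≡ {u} e)
  ... | ans1 = probes-on-tail-separate (nbrs G u)
                 (Adj⇒∈nbrs (probe≡ans1⇒Adj {u} e))
                 (Adj⇒∈nbrs (probe≡ans1⇒Adj {u} (trans (agree (ListAny.here refl)) e)))
                 (λ x∈ → agree (ListAny.there x∈))
  ... | ans∗ = ⊥-elim (seen refl)

  length-history : ∀ {k} (σ : Strategy G k) w t → length (history G σ w t) ≡ t
  length-history σ w zero    = refl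
  length-history σ w (suc t) = cong suc (length-history σ w t)

  module _ {k} (Q : ℕ → Vec V k) where

    oblivious : Strategy G k
    oblivious h = Q (length h)

    roundAnswers-oblivious : ∀ w t → roundAnswers G oblivious w t ≡ answers (Q t) (w t)
    roundAnswers-oblivious w t = cong (λ m → answers (Q m) (w t)) (length-history oblivious w t)

    located-oblivious : ∀ w t → (∀ r' → answers (Q t) r' ≡ answers (Q t) (w t) → r' ≡ w t) →
      Located G oblivious w t
    located-oblivious w t resolves w' _ same = resolves (w' t)
      (trans (≡-sym (roundAnswers-oblivious w' t))
        (trans (∷-injectiveˡ same) (roundAnswers-oblivious w t)))

  module _ {k} (σ : Strategy G k) (w : ℕ → V) where

    Alert : ℕ → Set
    Alert t = Any (_≢ ans∗) (roundAnswers G σ w t)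

    silent-or-alerted : ∀ t →
      history G σ w t ≡ silence k t ⊎ ∃ λ s → Alert s × history G σ w s ≡ silence k s
    silent-or-alerted zero = inj₁ refl
    silent-or-alerted (suc t) with silent-or-alerted t
    ... | inj₂ alerted = inj₂ alerted
    ... | inj₁ silent with any? (λ a → ¬? (is-∗? a)) (roundAnswers G σ w t)
    ...   | yes alert   = inj₂ (t , alert , silent)
    ...   | no no-alert = inj₁ (cong₂ _∷_ (all-∗ _ no-alert) silent)

    alert-while-silent : ∀ {s} → Alert s → history G σ w s ≡ silence k s →
      Any (λ u → probe G u (w s) ≢ ans∗) (σ (silence k s))
    alert-while-silent {s} alert silent =
      map⁻ (subst (λ h → Any (_≢ ans∗) (answers (σ h) (w s))) silent alert)

    alert-in-silent-play : ∀ t → Alert t →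
      ∃ λ s → Any (λ u → probe G u (w s) ≢ ans∗) (σ (silence k s))
    alert-in-silent-play t alert with silent-or-alerted t
    ... | inj₁ silent                = t , alert-while-silent alert silent
    ... | inj₂ (s , alert′ , silent) = s , alert-while-silent alert′ silent

  prox-positive : ∀ {p} → ProxCopsWin G p → 1 ≤ p
  prox-positive {zero} (σ , σ-wins)
    with _ , alert ← σ-wins (λ _ → Fin.fromℕ< (nonempty G)) (λ _ → inj₁ refl)
    = ⊥-elim (¬Any-Vec0 _ alert)
  prox-positive {suc _} _ = s≤s z≤n

  module _ (1≤Δ : 1 ≤ Δ G) where

    length-watch≤Δ : ∀ u → length (watch u) ≤ Δ G
    length-watch≤Δ u rewrite length-drop 1 (nbrs G u) = suc[m∸1]≤n 1≤Δ (degree≤Δ u)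

    watchAll : ∀ {k} → Vec V k → List V
    watchAll P = concatMap watch (Vec.toList P)

    length-watchAll : ∀ {k} (P : Vec V k) → length (watchAll P) ≤ Δ G * k
    length-watchAll {k} P = ≤-trans (length-concatMap-≤ length-watch≤Δ (Vec.toList P))
      (≤-reflexive (trans (cong (_* Δ G) (length-toList P)) (*-comm k (Δ G))))

    covering : ∀ {k} → Vec V k → Vec V (Δ G * k)
    covering P = Vec.padRight (length-watchAll P) (Fin.fromℕ< (nonempty G)) (Vec.fromList (watchAll P))

    watch⊆covering : ∀ {k} {P : Vec V k} {u x} → u ∈ P → x ∈ₗ watch u → x ∈ covering P
    watch⊆covering {P = P} u∈ x∈ =
      ∈-padRight⁺ (length-watchAll P) (∈-fromList⁺ (∈-concatMap⁺ watch (lose (∈-toList⁺ u∈) x∈)))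

    watching : ∀ {p} → Strategy G p → Strategy G (Δ G * p)
    watching {p} σ = oblivious (λ t → covering (σ (silence p t)))

    watching-wins : ∀ {p} (σ : Strategy G p) → ProxWinning G p σ → LocWinning G (Δ G * p) (watching σ)
    watching-wins σ σ-wins w walk
      with s , alert ← uncurry (alert-in-silent-play σ w) (σ-wins w walk)
      with u , u∈ , seen ← find alert
      = s , located-oblivious _ w s λ _ same →
              watch-locates seen (λ x∈ → map-cong⁻ _ same (watch⊆covering u∈ x∈))

mainTheorem13 : (G : Graph) → 2 ≤ n G → (z p : ℕ) → IsZeta1 G z → IsProx1 G p →
    z ≤ Δ G * p
mainTheorem13 G 2≤n z p (_ , _ , ζ-minimal) (prox@(σ , σ-wins) , _) =
  ζ-minimal (Δ G * p) (*-mono-≤ 1≤Δ (prox-positive G prox))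
    (watching G 1≤Δ σ , watching-wins G 1≤Δ σ σ-wins)
  where
  1≤Δ : 1 ≤ Δ G
  1≤Δ = Δ-positive G 2≤n
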